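{- Let $r \geq 2$ be an integer. If a Steiner system $S(2,r,n)$ exists, then there is a biregular bipartite graph $G$ of girth at least $6$ with $\chi_r(G) \geq n$.
   Context: A Steiner system $S(2,r,n)$ is a pair $(V,\mathcal{B})$ where $V$ is an $n$-element set and $\mathcal{B}$ is a family of $r$-element subsets of $V$ (blocks) such that every $2$-element subset of $V$ is contained in exactly one block. A bipartite graph with parts $X,Y$ is biregular if all vertices of $X$ have the same degree and all vertices of $Y$ have the same degree. The girth is the length of a shortest cycle (infinite if there is none). For a vertex $v$, $N(v)$ is its set of neighbors and $\deg(v)=|N(v)|$; for a coloring $\phi$ and a vertex set $U$, $\phi(U)=\{\phi(u):u\in U\}$. An $r$-hued coloring of a simple graph $G$ is a proper vertex coloring $\phi$ such that $|\phi(N(v))| \geq \min\{r,\deg(v)\}$ for every vertex $v$; $\chi_r(G)$ is the minimum number of colors in an $r$-hued coloring of $G$. -}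

module Defs where

open import Data.Nat using (ℕ; zero; suc; _≤_; _<_; _⊓_)
open import Data.Fin using (Fin; zero; suc; inject₁; fromℕ; _≟_)
open import Data.Fin.Subset using (Subset; _∈_; ∣_∣)
open import Data.Vec using (tabulate)
open import Data.Bool using (Bool; T; false)
open import Data.Bool.ListAction using (any)
open import Data.List using (List; map; _++_; filter; length; allFin)
open import Data.Sum using (_⊎_; inj₁; inj₂)
open import Data.Product using (Σ; _×_; _,_; ∃!)
open import Relation.Binary.PropositionalEquality using (_≡_)
open import Relation.Nullary using (¬_)
open import Relation.Nullary.Decidable using (⌊_⌋; T?)
open import Function.Definitions using (Injective)

record SteinerSystem (r n : ℕ) : Set where
  field
    m      : ℕ
    block  : Fin m → Subset n
    size   : ∀ i → ∣ block i ∣ ≡ r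
    unique : ∀ (x y : Fin n) → ¬ (x ≡ y) →
             ∃! _≡_ (λ i → x ∈ block i × y ∈ block i)

record BipartiteGraph : Set where
  field
    a b  : ℕ
    edge : Fin a → Fin b → Bool

module _ (G : BipartiteGraph) where
  open BipartiteGraph G

  Vertex : Set
  Vertex = Fin a ⊎ Fin b

  adj : Vertex → Vertex → Bool
  adj (inj₁ x) (inj₂ y) = edge x y
  adj (inj₂ y) (inj₁ x) = edge x y
  adj (inj₁ _) (inj₁ _) = false
  adj (inj₂ _) (inj₂ _) = false

  Adj : Vertex → Vertex → Set
  Adj u v = T (adj u v)

  vertices : List Vertex
  vertices = map inj₁ (allFin a) ++ map inj₂ (allFin b)

  nbrs : Vertex → List Vertex
  nbrs v = filter (λ u → T? (adj v u)) vertices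

  deg : Vertex → ℕ
  deg v = length (nbrs v)

  Biregular : Set
  Biregular = (∀ x x' → deg (inj₁ x) ≡ deg (inj₁ x'))
            × (∀ y y' → deg (inj₂ y) ≡ deg (inj₂ y'))

  -- a cycle of length suc k: pairwise distinct vertices c 0, …, c k with
  -- c i ~ c (i+1) and c k ~ c 0
  IsCycle : (k : ℕ) → (Fin (suc k) → Vertex) → Set
  IsCycle k c = Injective _≡_ _≡_ c
              × (∀ (i : Fin k) → Adj (c (inject₁ i)) (c (suc i)))
              × Adj (c (fromℕ k)) (c zero)

  GirthAtLeast : ℕ → Set
  GirthAtLeast g = ∀ k (c : Fin (suc k) → Vertex) →
                   3 ≤ suc k → suc k < g → ¬ IsCycle k c

  colourImage : ∀ {q} → (Vertex → Fin q) → List Vertex → Subset q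
  colourImage φ U = tabulate (λ c → any (λ u → ⌊ φ u ≟ c ⌋) U)

  IsRHued : (r : ℕ) {q : ℕ} → (Vertex → Fin q) → Set
  IsRHued r φ = (∀ u v → Adj u v → ¬ (φ u ≡ φ v))
              × (∀ v → r ⊓ deg v ≤ ∣ colourImage φ (nbrs v) ∣)

  ChiRAtLeast : (r n : ℕ) → Set
  ChiRAtLeast r n = ∀ q (φ : Vertex → Fin q) → IsRHued r φ → n ≤ q

{-# OPTIONS --safe #-}
module Submission where

-- The graph is the point–block incidence graph of the Steiner system.
-- Every block vertex has degree r, and double counting the pairs
-- (block through x, other point of that block) shows that every point
-- lies on exactly (n - 1)/(r - 1) blocks.  The graph is bipartite, so it
-- has no odd cycles, and a 4-cycle would put two points on two common
-- blocks.  Finally, any two points are neighbours of the block through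
-- them, a vertex of degree r, so an r-hued colouring gives them distinct
-- colours: the points alone already need n colours.

open import Defs
open import Data.Bool using (Bool; true; false; T; not; _∧_)
open import Data.Bool.Properties using (not-involutive; not-¬; T-≡; T-∧)
open import Data.Bool.ListAction using (any)
open import Data.Empty using (⊥)
open import Data.Fin using (Fin; zero; suc; _≟_; inject₁; fromℕ; punchIn)
open import Data.Fin.Properties using (punchInᵢ≢i; injective⇒≤)
open import Data.Fin.Subset using (Subset; _∈_; _⊆_; _∪_; ⁅_⁆; ∣_∣)
open import Data.Fin.Subset.Properties using (p⊆q⇒∣p∣≤∣q∣; ∣p∣≤∣x∷p∣; ∣⁅x⁆∣≡1; x∈⁅x⁆; x∈p∪q⁺)
open import Data.List using (List; []; _∷_; _++_; map; filter; length; allFin)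
import Data.List as List
open import Data.List.Properties using (filter-++; length-++; length-++-sucʳ; map-tabulate)
open import Data.List.Membership.Propositional using (find; lose) renaming (_∈_ to _∈ₗ_)
open import Data.List.Membership.Propositional.Properties
  using (∈-filter⁺; ∈-tabulate⁺; ∈-map⁺; ∈-++⁺ˡ; ∈-++⁺ʳ; ∈-∃++)
open import Data.List.Relation.Unary.Any using (here; there)
open import Data.List.Relation.Unary.Any.Properties using (any⁺; any⁻)
open import Data.Nat using (ℕ; zero; suc; _≤_; _+_; _*_; _∸_; _<_; z≤n; s≤s; >-nonZero)
open import Data.Nat.GeneralisedArithmetic using (fold)
open import Data.Nat.Properties
  using ( ≤-trans; ≤-reflexive; <⇒≱; n<1+n; +-suc; +-identityʳ; +-monoʳ-≤; *-identityʳ; *-zeroʳ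
        ; *-distribˡ-∸; m+n∸m≡n; m<n⇒0<n∸m; *-cancelʳ-≡; m≥n⇒m⊓n≡n; +-*-semiring; module ≤-Reasoning)
open import Data.Product using (Σ; _×_; _,_; ∃; ∃!; proj₁; proj₂)
import Data.Product as Product
open import Data.Sum using (_⊎_; inj₁; inj₂)
import Data.Sum as Sum
open import Data.Sum.Properties using (inj₁-injective)
open import Data.Vec using ([]; _∷_; lookup; tabulate)
open import Data.Vec.Properties using ([]=⇒lookup; lookup⇒[]=; lookup∘tabulate; tabulate∘lookup)
open import Function using (_∘_; _⇔_; mk⇔; Equivalence)
open Equivalence using (to; from)
open import Function.Definitions using (Injective)
open import Relation.Binary.PropositionalEquality
  using (_≡_; _≢_; refl; sym; trans; cong; cong₂; subst; module ≡-Reasoning)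
open import Relation.Nullary using (¬_; yes; no; contradiction)
open import Relation.Nullary.Decidable using (⌊_⌋; T?; toWitness; fromWitness)

open import Algebra.Properties.Semiring.Sum +-*-semiring
  using (sum; sum-cong-≗; sum-remove; ∑-comm; *-distribˡ-sum; *-distribʳ-sum; sum-replicate-zero)

𝟙 : Bool → ℕ
𝟙 true  = 1
𝟙 false = 0

𝟙-T : ∀ {b} → T b → 𝟙 b ≡ 1
𝟙-T {true} _ = refl

𝟙-¬T : ∀ {b} → ¬ T b → 𝟙 b ≡ 0
𝟙-¬T {true}  ¬t = contradiction _ ¬t
𝟙-¬T {false} _  = refl

𝟙-∧ : ∀ a b → 𝟙 (a ∧ b) ≡ 𝟙 a * 𝟙 b
𝟙-∧ true  b = sym (+-identityʳ (𝟙 b))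
𝟙-∧ false b = refl

𝟙-*-idem : ∀ b → 𝟙 b * 𝟙 b ≡ 𝟙 b
𝟙-*-idem true  = refl
𝟙-*-idem false = refl

count : ∀ {n} → (Fin n → Bool) → ℕ
count p = sum (𝟙 ∘ p)

sum-const : ∀ n c → sum {n} (λ _ → c) ≡ n * c
sum-const zero    c = refl
sum-const (suc n) c = cong (c +_) (sum-const n c)

sum-const-except : ∀ {n} (t : Fin n → ℕ) (i : Fin n) {c} → (∀ j → j ≢ i → t j ≡ c) →
                   sum t ≡ t i + (n ∸ 1) * c
sum-const-except {suc n} t i {c} t≡c = begin
  sum t                        ≡⟨ sum-remove t ⟩
  t i + sum (t ∘ punchIn i)    ≡⟨ cong (t i +_) (sum-cong-≗ λ j → t≡c (punchIn i j) (punchInᵢ≢i i j)) ⟩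
  t i + sum {n} (λ _ → c)      ≡⟨ cong (t i +_) (sum-const n c) ⟩
  t i + n * c                  ∎
  where open ≡-Reasoning

count-unique : ∀ {n} (p : Fin n → Bool) → ∃! _≡_ (T ∘ p) → count p ≡ 1
count-unique {n} p (w , pw , w-unique) = begin
  count p                   ≡⟨ sum-const-except (𝟙 ∘ p) w others ⟩
  𝟙 (p w) + (n ∸ 1) * 0     ≡⟨ cong₂ _+_ (𝟙-T pw) (*-zeroʳ (n ∸ 1)) ⟩
  1                         ∎
  where
  open ≡-Reasoning
  others : ∀ j → j ≢ w → 𝟙 (p j) ≡ 0
  others j j≢w = 𝟙-¬T (λ pj → j≢w (sym (w-unique pj)))

∣tabulate∣≡count : ∀ {n} (p : Fin n → Bool) → ∣ tabulate p ∣ ≡ count p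
∣tabulate∣≡count {zero}  p = refl
∣tabulate∣≡count {suc n} p with p zero
... | true  = cong suc (∣tabulate∣≡count (p ∘ suc))
... | false = ∣tabulate∣≡count (p ∘ suc)

length-filter-tabulate : ∀ {A : Set} {n} (p : A → Bool) (f : Fin n → A) →
                         length (filter (T? ∘ p) (List.tabulate f)) ≡ count (p ∘ f)
length-filter-tabulate {n = zero}  p f = refl
length-filter-tabulate {n = suc n} p f with p (f zero)
... | true  = cong suc (length-filter-tabulate p (f ∘ suc))
... | false = length-filter-tabulate p (f ∘ suc)

∈⇔T-lookup : ∀ {n} {x : Fin n} {p : Subset n} → x ∈ p ⇔ T (lookup p x)
∈⇔T-lookup {x = x} {p} = mk⇔ (from T-≡ ∘ []=⇒lookup) (lookup⇒[]= x p ∘ to T-≡)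

∣p∪q∣≤∣p∣+∣q∣ : ∀ {n} (p q : Subset n) → ∣ p ∪ q ∣ ≤ ∣ p ∣ + ∣ q ∣
∣p∪q∣≤∣p∣+∣q∣ []           []           = z≤n
∣p∪q∣≤∣p∣+∣q∣ (true  ∷ p)  (s ∷ q)      =
  s≤s (≤-trans (∣p∪q∣≤∣p∣+∣q∣ p q) (+-monoʳ-≤ ∣ p ∣ (∣p∣≤∣x∷p∣ s q)))
∣p∪q∣≤∣p∣+∣q∣ (false ∷ p)  (true  ∷ q)  =
  ≤-trans (s≤s (∣p∪q∣≤∣p∣+∣q∣ p q)) (≤-reflexive (sym (+-suc ∣ p ∣ ∣ q ∣)))
∣p∪q∣≤∣p∣+∣q∣ (false ∷ p)  (false ∷ q)  = ∣p∪q∣≤∣p∣+∣q∣ p q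

∈-++-∷⁻ : ∀ {A : Set} (U₁ : List A) {y U₂ u} → u ∈ₗ U₁ ++ y ∷ U₂ → u ≡ y ⊎ u ∈ₗ U₁ ++ U₂
∈-++-∷⁻ []       (here u≡y)  = inj₁ u≡y
∈-++-∷⁻ []       (there u∈)  = inj₂ u∈
∈-++-∷⁻ (_ ∷ U₁) (here u≡x)  = inj₂ (here u≡x)
∈-++-∷⁻ (_ ∷ U₁) (there u∈)  = Sum.map₂ there (∈-++-∷⁻ U₁ u∈)

module _ {A : Set} {q : ℕ} (f : A → Fin q) where

  image : List A → Subset q
  image U = tabulate (λ c → any (λ u → ⌊ f u ≟ c ⌋) U)

  ∈-image⁺ : ∀ {u U} → u ∈ₗ U → f u ∈ image U
  ∈-image⁺ {u} {U} u∈U = from ∈⇔T-lookup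
    (subst T (sym (lookup∘tabulate _ (f u))) (any⁺ _ (lose u∈U (fromWitness refl))))

  ∈-image⁻ : ∀ U {c} → c ∈ image U → ∃ λ u → u ∈ₗ U × f u ≡ c
  ∈-image⁻ U {c} c∈ =
    Product.map₂ (Product.map₂ toWitness)
      (find (any⁻ _ U (subst T (lookup∘tabulate _ c) (to ∈⇔T-lookup c∈))))

  image-mono : ∀ U V → (∀ {u} → u ∈ₗ U → ∃ λ w → w ∈ₗ V × f w ≡ f u) → image U ⊆ image V
  image-mono U V cover c∈ with u , u∈U , refl ← ∈-image⁻ U c∈ with w , w∈V , fw≡fu ← cover u∈U =
    subst (_∈ image V) fw≡fu (∈-image⁺ w∈V)

  ∣image∣≤length : ∀ U → ∣ image U ∣ ≤ length U
  ∣image∣≤length []      = ≤-reflexive (trans (∣tabulate∣≡count {q} (λ _ → false)) (sum-replicate-zero q))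
  ∣image∣≤length (u ∷ U) = begin
    ∣ image (u ∷ U) ∣          ≤⟨ p⊆q⇒∣p∣≤∣q∣ image-∷⊆ ⟩
    ∣ ⁅ f u ⁆ ∪ image U ∣      ≤⟨ ∣p∪q∣≤∣p∣+∣q∣ ⁅ f u ⁆ (image U) ⟩
    ∣ ⁅ f u ⁆ ∣ + ∣ image U ∣  ≡⟨ cong (_+ ∣ image U ∣) (∣⁅x⁆∣≡1 (f u)) ⟩
    suc ∣ image U ∣            ≤⟨ s≤s (∣image∣≤length U) ⟩
    suc (length U)             ∎
    where
    open ≤-Reasoning
    image-∷⊆ : image (u ∷ U) ⊆ ⁅ f u ⁆ ∪ image U
    image-∷⊆ c∈ with ∈-image⁻ (u ∷ U) c∈
    ... | _ , here refl , refl = x∈p∪q⁺ (inj₁ (x∈⁅x⁆ (f u)))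
    ... | _ , there w∈U , refl = x∈p∪q⁺ (inj₂ (∈-image⁺ w∈U))

  image-collision : ∀ {x y U} → x ∈ₗ U → y ∈ₗ U → x ≢ y → f x ≡ f y → ∣ image U ∣ < length U
  image-collision {x} {y} x∈U y∈U x≢y fx≡fy with U₁ , U₂ , refl ← ∈-∃++ y∈U = begin-strict
    ∣ image (U₁ ++ y ∷ U₂) ∣   ≤⟨ p⊆q⇒∣p∣≤∣q∣ (image-mono (U₁ ++ y ∷ U₂) (U₁ ++ U₂) cover) ⟩
    ∣ image (U₁ ++ U₂) ∣       ≤⟨ ∣image∣≤length (U₁ ++ U₂) ⟩
    length (U₁ ++ U₂)          <⟨ n<1+n _ ⟩
    suc (length (U₁ ++ U₂))    ≡⟨ length-++-sucʳ U₁ y U₂ ⟨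
    length (U₁ ++ y ∷ U₂)      ∎
    where
    open ≤-Reasoning
    x∈U′ : x ∈ₗ U₁ ++ U₂
    x∈U′ = Sum.fromInj₂ (λ x≡y → contradiction x≡y x≢y) (∈-++-∷⁻ U₁ x∈U)
    cover : ∀ {u} → u ∈ₗ U₁ ++ y ∷ U₂ → ∃ λ w → w ∈ₗ U₁ ++ U₂ × f w ≡ f u
    cover u∈ with ∈-++-∷⁻ U₁ u∈
    ... | inj₁ refl = x , x∈U′ , fx≡fy
    ... | inj₂ u∈U′ = _ , u∈U′ , refl

fold-not-odd : ∀ b k → fold b not (suc (k + k)) ≡ not b
fold-not-odd b zero    = refl
fold-not-odd b (suc k) = begin
  not (not (fold b not (k + suc k)))   ≡⟨ not-involutive _ ⟩
  fold b not (k + suc k)               ≡⟨ cong (fold b not) (+-suc k k) ⟩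
  fold b not (suc (k + k))             ≡⟨ fold-not-odd b k ⟩
  not b                                ∎
  where open ≡-Reasoning

module _ (G : BipartiteGraph) where
  open BipartiteGraph G

  deg≡count : ∀ v → deg G v ≡ count (adj G v ∘ inj₁) + count (adj G v ∘ inj₂)
  deg≡count v = begin
    length (filter P? (map inj₁ (allFin a) ++ map inj₂ (allFin b)))
      ≡⟨ cong length (filter-++ P? (map inj₁ (allFin a)) (map inj₂ (allFin b))) ⟩
    length (filter P? (map inj₁ (allFin a)) ++ filter P? (map inj₂ (allFin b)))
      ≡⟨ length-++ (filter P? (map inj₁ (allFin a))) ⟩
    length (filter P? (map inj₁ (allFin a))) + length (filter P? (map inj₂ (allFin b)))
      ≡⟨ cong₂ (λ X Y → length (filter P? X) + length (filter P? Y))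
               (map-tabulate (λ x → x) inj₁) (map-tabulate (λ y → y) inj₂) ⟩
    length (filter P? (List.tabulate inj₁)) + length (filter P? (List.tabulate inj₂))
      ≡⟨ cong₂ _+_ (length-filter-tabulate (adj G v) inj₁) (length-filter-tabulate (adj G v) inj₂) ⟩
    count (adj G v ∘ inj₁) + count (adj G v ∘ inj₂)
      ∎
    where
    open ≡-Reasoning
    P? = T? ∘ adj G v

  deg-inj₁ : ∀ x → deg G (inj₁ x) ≡ count (edge x)
  deg-inj₁ x = trans (deg≡count (inj₁ x)) (cong (_+ count (edge x)) (sum-replicate-zero a))

  deg-inj₂ : ∀ y → deg G (inj₂ y) ≡ count (λ x → edge x y)
  deg-inj₂ y = trans (deg≡count (inj₂ y))
                     (trans (cong (count (λ x → edge x y) +_) (sum-replicate-zero b)) (+-identityʳ _))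

  ∈-nbrs⁺ : ∀ v {u} → Adj G v u → u ∈ₗ nbrs G v
  ∈-nbrs⁺ v {u} = ∈-filter⁺ (T? ∘ adj G v) (∈-vertices u)
    where
    ∈-vertices : ∀ u → u ∈ₗ vertices G
    ∈-vertices (inj₁ x) = ∈-++⁺ˡ (∈-map⁺ inj₁ (∈-tabulate⁺ x))
    ∈-vertices (inj₂ y) = ∈-++⁺ʳ (map inj₁ (allFin a)) (∈-map⁺ inj₂ (∈-tabulate⁺ y))

  rHued-nbrs-distinct : ∀ {r q} {φ : Vertex G → Fin q} → IsRHued G r φ →
                        ∀ v {u w} → deg G v ≤ r → Adj G v u → Adj G v w → u ≢ w → φ u ≢ φ w
  rHued-nbrs-distinct {r} {φ = φ} (_ , hued) v deg≤r v~u v~w u≢w φu≡φw =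
    <⇒≱ (image-collision φ (∈-nbrs⁺ v v~u) (∈-nbrs⁺ v v~w) u≢w φu≡φw)
        (subst (_≤ ∣ image φ (nbrs G v) ∣) (m≥n⇒m⊓n≡n deg≤r) (hued v))

  side : Vertex G → Bool
  side (inj₁ _) = true
  side (inj₂ _) = false

  side-flip : ∀ u v → Adj G u v → side v ≡ not (side u)
  side-flip (inj₁ _) (inj₂ _) _ = refl
  side-flip (inj₂ _) (inj₁ _) _ = refl

  walk-side : ∀ k (c : Fin (suc k) → Vertex G) →
              (∀ (i : Fin k) → Adj G (c (inject₁ i)) (c (suc i))) →
              side (c (fromℕ k)) ≡ fold (side (c zero)) not k
  walk-side zero    c step = refl
  walk-side (suc k) c step =
    trans (side-flip (c (inject₁ (fromℕ k))) (c (suc (fromℕ k))) (step (fromℕ k)))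
          (cong not (walk-side k (c ∘ inject₁) (step ∘ inject₁)))

  odd-cycle-free : ∀ k (c : Fin (suc (k + k)) → Vertex G) → ¬ IsCycle G (k + k) c
  odd-cycle-free k c (_ , step , close) = not-¬ refl (begin
    side (c zero)                            ≡⟨ side-flip (c (fromℕ (k + k))) (c zero) close ⟩
    not (side (c (fromℕ (k + k))))           ≡⟨ cong not (walk-side (k + k) c step) ⟩
    fold (side (c zero)) not (suc (k + k))   ≡⟨ fold-not-odd (side (c zero)) k ⟩
    not (side (c zero))                      ∎)
    where open ≡-Reasoning

  AtMostOneCommonNeighbour : Set
  AtMostOneCommonNeighbour = ∀ {x x′ y y′} → x ≢ x′ →
    T (edge x y) → T (edge x′ y) → T (edge x y′) → T (edge x′ y′) → y ≡ y′

  square-free : AtMostOneCommonNeighbour → ∀ c → ¬ IsCycle G 3 c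
  square-free linear c (c-injective , step , close) =
    square (c zero) (c (suc zero)) (c (suc (suc zero))) (c (suc (suc (suc zero))))
      (λ e → contradiction (c-injective e) λ ()) (λ e → contradiction (c-injective e) λ ())
      (step zero) (step (suc zero)) (step (suc (suc zero))) close
    where
    square : ∀ v₀ v₁ v₂ v₃ → v₀ ≢ v₂ → v₁ ≢ v₃ →
             Adj G v₀ v₁ → Adj G v₁ v₂ → Adj G v₂ v₃ → Adj G v₃ v₀ → ⊥
    square (inj₁ x) (inj₂ y) (inj₁ x′) (inj₂ y′) x≢x′ y≢y′ e₀ e₁ e₂ e₃ =
      y≢y′ (cong inj₂ (linear (x≢x′ ∘ cong inj₁) e₀ e₁ e₃ e₂))
    square (inj₂ y) (inj₁ x) (inj₂ y′) (inj₁ x′) y≢y′ x≢x′ e₀ e₁ e₂ e₃ =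
      y≢y′ (cong inj₂ (linear (x≢x′ ∘ cong inj₁) e₀ e₃ e₁ e₂))
    square (inj₁ _) (inj₁ _) _        _        _ _ () _  _  _
    square (inj₂ _) (inj₂ _) _        _        _ _ () _  _  _
    square _        (inj₁ _) (inj₁ _) _        _ _ _  () _  _
    square _        (inj₂ _) (inj₂ _) _        _ _ _  () _  _
    square _        _        (inj₁ _) (inj₁ _) _ _ _  _  () _
    square _        _        (inj₂ _) (inj₂ _) _ _ _  _  () _

module IncidenceGraph {r n : ℕ} (S : SteinerSystem r n) where
  open SteinerSystem S

  incident : Fin n → Fin m → Bool
  incident x i = lookup (block i) x

  incidence : BipartiteGraph
  incidence = record { a = n ; b = m ; edge = incident }

  replication : Fin n → ℕ
  replication x = count (incident x)

  block-count : ∀ i → count (λ x → incident x i) ≡ r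
  block-count i = begin
    count (lookup (block i))          ≡⟨ ∣tabulate∣≡count (lookup (block i)) ⟨
    ∣ tabulate (lookup (block i)) ∣   ≡⟨ cong ∣_∣ (tabulate∘lookup (block i)) ⟩
    ∣ block i ∣                       ≡⟨ size i ⟩
    r                                 ∎
    where open ≡-Reasoning

  common-block : ∀ {x y} → x ≢ y → ∃! _≡_ (λ i → T (incident x i ∧ incident y i))
  common-block {x} {y} x≢y with w , x,y∈w , w-unique ← unique x y x≢y =
    w , from T-∧ (Product.map (to ∈⇔T-lookup) (to ∈⇔T-lookup) x,y∈w) ,
    λ t → w-unique (Product.map (from ∈⇔T-lookup) (from ∈⇔T-lookup) (to T-∧ t))

  incidence-linear : AtMostOneCommonNeighbour incidence
  incidence-linear x≢x′ xi x′i xj x′j with _ , _ , w-unique ← common-block x≢x′ =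
    trans (sym (w-unique (from T-∧ (xi , x′i)))) (w-unique (from T-∧ (xj , x′j)))

  replication-identity : ∀ x → replication x * r ≡ replication x + (n ∸ 1)
  replication-identity x = begin
    replication x * r
      ≡⟨ *-distribʳ-sum r (𝟙 ∘ incident x) ⟩
    sum (λ i → 𝟙 (incident x i) * r)
      ≡⟨ sum-cong-≗ (λ i → cong (𝟙 (incident x i) *_) (block-count i)) ⟨
    sum (λ i → 𝟙 (incident x i) * count (λ y → incident y i))
      ≡⟨ sum-cong-≗ (λ i → *-distribˡ-sum (𝟙 (incident x i)) (λ y → 𝟙 (incident y i))) ⟩
    sum (λ i → sum (λ y → 𝟙 (incident x i) * 𝟙 (incident y i)))
      ≡⟨ ∑-comm (λ i y → 𝟙 (incident x i) * 𝟙 (incident y i)) ⟩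
    sum (λ y → sum (λ i → 𝟙 (incident x i) * 𝟙 (incident y i)))
      ≡⟨ sum-const-except _ x pairs-once ⟩
    sum (λ i → 𝟙 (incident x i) * 𝟙 (incident x i)) + (n ∸ 1) * 1
      ≡⟨ cong₂ _+_ (sum-cong-≗ (λ i → 𝟙-*-idem (incident x i))) (*-identityʳ (n ∸ 1)) ⟩
    replication x + (n ∸ 1)
      ∎
    where
    open ≡-Reasoning
    pairs-once : ∀ y → y ≢ x → sum (λ i → 𝟙 (incident x i) * 𝟙 (incident y i)) ≡ 1
    pairs-once y y≢x = trans (sum-cong-≗ (λ i → sym (𝟙-∧ (incident x i) (incident y i))))
                             (count-unique _ (common-block (y≢x ∘ sym)))

  replication-number : ∀ x → replication x * (r ∸ 1) ≡ n ∸ 1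
  replication-number x = begin
    replication x * (r ∸ 1)
      ≡⟨ *-distribˡ-∸ (replication x) r 1 ⟩
    replication x * r ∸ replication x * 1
      ≡⟨ cong₂ _∸_ (replication-identity x) (*-identityʳ (replication x)) ⟩
    replication x + (n ∸ 1) ∸ replication x
      ≡⟨ m+n∸m≡n (replication x) (n ∸ 1) ⟩
    n ∸ 1
      ∎
    where open ≡-Reasoning

  deg-block : ∀ i → deg incidence (inj₂ i) ≡ r
  deg-block i = trans (deg-inj₂ incidence i) (block-count i)

  incidence-biregular : 2 ≤ r → Biregular incidence
  incidence-biregular 2≤r = points , blocks
    where
    instance r∸1≢0 = >-nonZero (m<n⇒0<n∸m 2≤r)
    points : ∀ x x′ → deg incidence (inj₁ x) ≡ deg incidence (inj₁ x′)
    points x x′ = begin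
      deg incidence (inj₁ x)   ≡⟨ deg-inj₁ incidence x ⟩
      replication x            ≡⟨ *-cancelʳ-≡ _ _ (r ∸ 1) (trans (replication-number x)
                                                              (sym (replication-number x′))) ⟩
      replication x′           ≡⟨ deg-inj₁ incidence x′ ⟨
      deg incidence (inj₁ x′)  ∎
      where open ≡-Reasoning
    blocks : ∀ i j → deg incidence (inj₂ i) ≡ deg incidence (inj₂ j)
    blocks i j = trans (deg-block i) (sym (deg-block j))

  incidence-girth≥6 : GirthAtLeast incidence 6
  incidence-girth≥6 0 c (s≤s ())
  incidence-girth≥6 1 c (s≤s (s≤s ()))
  incidence-girth≥6 2 c _ _ = odd-cycle-free incidence 1 c
  incidence-girth≥6 3 c _ _ = square-free incidence incidence-linear c
  incidence-girth≥6 4 c _ _ = odd-cycle-free incidence 2 c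
  incidence-girth≥6 (suc (suc (suc (suc (suc k))))) c _ (s≤s (s≤s (s≤s (s≤s (s≤s (s≤s ()))))))

  incidence-χ≥n : ChiRAtLeast incidence r n
  incidence-χ≥n q φ hued = injective⇒≤ points-distinct
    where
    points-distinct : Injective _≡_ _≡_ (φ ∘ inj₁)
    points-distinct {x} {y} φx≡φy with x ≟ y
    ... | yes x≡y = x≡y
    ... | no x≢y with i , xy∈i , _ ← common-block x≢y =
      contradiction φx≡φy
        (rHued-nbrs-distinct incidence hued (inj₂ i) (≤-reflexive (deg-block i))
          (proj₁ (to T-∧ xy∈i)) (proj₂ (to T-∧ xy∈i)) (x≢y ∘ inj₁-injective))

theorem5 : (r n : ℕ) → 2 ≤ r → SteinerSystem r n →
    Σ BipartiteGraph (λ G → Biregular G × GirthAtLeast G 6 × ChiRAtLeast G r n)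
theorem5 r n 2≤r S = incidence , incidence-biregular 2≤r , incidence-girth≥6 , incidence-χ≥n
  where open IncidenceGraph S
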